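{- Consider Girard's system F over the base types $e_1,\dots,e_n,t$, together with constants $c_{ij}:e_i\to e_j$ for a given set of base coercions. Consider the term-annotated coercive subtyping system whose judgements have the form $x:A < s:B$ (with $A,B$ types of system F and $s$ a term of type $B$), whose axioms are $x:e_i < c_{ij}(x):e_j$ for each base coercion constant $c_{ij}$, and whose rules are: (transitivity) from $x:A<t:B$ and $y:B<u:C$ derive $x:A<u[y:=t]:C$; (arrow, both sides) from $x:A<t:B$ and $z:C<u:D$ derive $f:D\to A < \lambda z^C.\, t[x:=f(u)] : C\to B$; (arrow, covariant) from $x:A<t:B$ derive $f:T\to A<\lambda w^T.\, t[x:=f(w)]:T\to B$; (arrow, contravariant) from $x:A<t:B$ derive $g:B\to T<\lambda x^A.\, g(t):A\to T$; (type-quantifier introduction) from $u:U<t:T[X]$ derive $u:U<\Lambda X.\, t:\Pi X.\,T[X]$, provided $X$ is not free in $U$; (type-quantifier elimination) from $u:U<t:\Pi X.\,T[X]$ derive $u:U<t\{W\}:T[W]$ for any type $W$. Then every term $s$ appearing on the right of a derivable judgement $v:A<s:B$ is linear: it has exactly one free variable, namely the variable $v$ (whose type $A$ is the one on the left of $<$), and this variable has a single occurrence in $s$ (the constants $c_{ij}$ aside).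
   Context: System F types: base types $e_1,\dots,e_n$ (sorts of entities) and $t$ (propositions), type variables, $\Pi\alpha.\,T$, and $T_1\to T_2$. Terms: variables and constants of each type, application $(f\,\tau)$, abstraction $\lambda x^T.\,\tau$, type application $\tau\{U\}$, and type abstraction $\Lambda\alpha.\,\tau$ (with the usual restriction that $\alpha$ is not free in the type of a free variable of $\tau$). The base coercions $c_{ij}:e_i\to e_j$ form a transitive and acyclic relation on base types, with at most one coercion between any two base types, and satisfy $c_{jk}\circ c_{ij}=c_{ik}$. The judgement $A<B$ means "$A$ is a (coercive) subtype of $B$". -}

module Defs where

open import Data.Nat using (ℕ; zero; suc; _+_; _≟_)
open import Data.Fin using (Fin)
open import Data.Product using (_×_)
open import Relation.Nullary using (¬_; yes; no)
open import Relation.Binary.PropositionalEquality using (_≡_; _≢_)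

-- Locally nameless representation: free (type/term) variables are names (ℕ),
-- bound variables are de Bruijn indices (ℕ).  Names   = ℕ.

Name : Set
Name = ℕ

record BaseCoercions (n : ℕ) : Set₁ where
  field
    _⊏_      : Fin n → Fin n → Set          -- i ⊏ j : there is a coercion c_ij : e_i → e_j
    ⊏-trans  : ∀ {i j k} → i ⊏ j → j ⊏ k → i ⊏ k
    ⊏-irrefl : ∀ i → ¬ (i ⊏ i)              -- acyclic (for a transitive relation)
    ⊏-unique : ∀ {i j} (p q : i ⊏ j) → p ≡ q -- at most one coercion between two base types
  -- The equation c_jk ∘ c_ij = c_ik concerns the equational theory of terms,
  -- not the derivation system, and plays no role in this syntactic statement.

data Ty (n : ℕ) : Set where
  base : Fin n → Ty n
  prop : Ty n
  tfv  : Name → Ty n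
  tbv  : ℕ → Ty n
  _⇒_  : Ty n → Ty n → Ty n
  Π    : Ty n → Ty n           -- body uses tbv 0 for the bound variable

infixr 7 _⇒_

module _ {n : ℕ} where

  closeTy : ℕ → Name → Ty n → Ty n
  closeTy k X (base i) = base i
  closeTy k X prop = prop
  closeTy k X (tfv Y) with X ≟ Y
  ... | yes _ = tbv k
  ... | no  _ = tfv Y
  closeTy k X (tbv m) = tbv m
  closeTy k X (A ⇒ B) = closeTy k X A ⇒ closeTy k X B
  closeTy k X (Π A) = Π (closeTy (suc k) X A)

  openTy : ℕ → Ty n → Ty n → Ty n
  openTy k W (base i) = base i
  openTy k W prop = prop
  openTy k W (tfv Y) = tfv Y
  openTy k W (tbv m) with k ≟ m
  ... | yes _ = W
  ... | no  _ = tbv m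
  openTy k W (A ⇒ B) = openTy k W A ⇒ openTy k W B
  openTy k W (Π A) = Π (openTy (suc k) W A)

  ΠX : Name → Ty n → Ty n
  ΠX X T = Π (closeTy 0 X T)

  instTy : Ty n → Ty n → Ty n
  instTy T W = openTy 0 W T

  data _∈FTV_ (X : Name) : Ty n → Set where
    here : X ∈FTV tfv X
    ⇒ˡ   : ∀ {A B} → X ∈FTV A → X ∈FTV (A ⇒ B)
    ⇒ʳ   : ∀ {A B} → X ∈FTV B → X ∈FTV (A ⇒ B)
    Πᵇ   : ∀ {A} → X ∈FTV A → X ∈FTV Π A

data Tm (n : ℕ) : Set where
  fv   : Name → Tm n
  bv   : ℕ → Tm n
  coe  : Fin n → Fin n → Tm n
  app  : Tm n → Tm n → Tm n
  lam  : Ty n → Tm n → Tm n          -- λ x^T. τ   (body uses bv 0)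
  tapp : Tm n → Ty n → Tm n
  tlam : Tm n → Tm n                 -- Λα. τ      (body uses tbv 0)

module _ {n : ℕ} where

  closeTm : ℕ → Name → Tm n → Tm n
  closeTm k x (fv y) with x ≟ y
  ... | yes _ = bv k
  ... | no  _ = fv y
  closeTm k x (bv m) = bv m
  closeTm k x (coe i j) = coe i j
  closeTm k x (app s t) = app (closeTm k x s) (closeTm k x t)
  closeTm k x (lam A t) = lam A (closeTm (suc k) x t)
  closeTm k x (tapp t A) = tapp (closeTm k x t) A
  closeTm k x (tlam t) = tlam (closeTm k x t)

  closeTmTy : ℕ → Name → Tm n → Tm n
  closeTmTy k X (fv y) = fv y
  closeTmTy k X (bv m) = bv m
  closeTmTy k X (coe i j) = coe i j
  closeTmTy k X (app s t) = app (closeTmTy k X s) (closeTmTy k X t)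
  closeTmTy k X (lam A t) = lam (closeTy k X A) (closeTmTy k X t)
  closeTmTy k X (tapp t A) = tapp (closeTmTy k X t) (closeTy k X A)
  closeTmTy k X (tlam t) = tlam (closeTmTy (suc k) X t)

  ƛ : Name → Ty n → Tm n → Tm n
  ƛ z C t = lam C (closeTm 0 z t)

  Λ : Name → Tm n → Tm n
  Λ X t = tlam (closeTmTy 0 X t)

  _[_≔_] : Tm n → Name → Tm n → Tm n
  fv y [ x ≔ s ] with x ≟ y
  ... | yes _ = s
  ... | no  _ = fv y
  bv m [ x ≔ s ] = bv m
  coe i j [ x ≔ s ] = coe i j
  app t u [ x ≔ s ] = app (t [ x ≔ s ]) (u [ x ≔ s ])
  lam A t [ x ≔ s ] = lam A (t [ x ≔ s ])
  tapp t A [ x ≔ s ] = tapp (t [ x ≔ s ]) A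
  tlam t [ x ≔ s ] = tlam (t [ x ≔ s ])

  occ : Name → Tm n → ℕ
  occ y (fv z) with y ≟ z
  ... | yes _ = 1
  ... | no  _ = 0
  occ y (bv m) = 0
  occ y (coe i j) = 0
  occ y (app s t) = occ y s + occ y t
  occ y (lam A t) = occ y t
  occ y (tapp t A) = occ y t
  occ y (tlam t) = occ y t

  Linear : Name → Tm n → Set
  Linear v s = (occ v s ≡ 1) × (∀ y → y ≢ v → occ y s ≡ 0)

module _ {n : ℕ} (R : BaseCoercions n) where
  open BaseCoercions R

  -- Der x A s B  means the judgement  x : A < s : B
  data Der : Name → Ty n → Tm n → Ty n → Set where
    axiom : ∀ {i j} (x : Name) → i ⊏ j →
            Der x (base i) (app (coe i j) (fv x)) (base j)
    trans : ∀ {x y A B C t u} →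
            Der x A (t) B → Der y B (u) C →
            Der x A (u [ y ≔ t ]) C
    arrow : ∀ {x z A B C D t u} (f : Name) → f ≢ z →
            Der x A (t) B → Der z C (u) D →
            Der f (D ⇒ A) (ƛ z C (t [ x ≔ app (fv f) u ])) (C ⇒ B)
    arrow-cov : ∀ {x A B t} (f w : Name) (T : Ty n) → f ≢ w →
            Der x A (t) B →
            Der f (T ⇒ A) (ƛ w T (t [ x ≔ app (fv f) (fv w) ])) (T ⇒ B)
    arrow-contra : ∀ {x A B t} (g : Name) (T : Ty n) → g ≢ x →
            Der x A (t) B →
            Der g (B ⇒ T) (ƛ x A (app (fv g) t)) (A ⇒ T)
    Π-intro : ∀ {u U t T} (X : Name) → ¬ (X ∈FTV U) →
            Der u U (t) T →
            Der u U (Λ X t) (ΠX X T)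
    Π-elim : ∀ {u U t T} (W : Ty n) →
            Der u U (t) (Π T) →
            Der u U (tapp t W) (instTy T W)

-- Call two terms occurrence-equivalent (≈ₒ) when every variable occurs equally often in
-- both; a term is linear in v exactly when it is equivalent to the variable v itself.
-- Coercion constants and type abstraction/application leave occurrence counts unchanged,
-- substituting t for the single occurrence of y in u gives a term equivalent to t, and
-- binding z in f z (f ≢ z) gives a term equivalent to f.  Every rule is a combination of
-- these steps, so by induction the right-hand term of v : A < s : B is equivalent to v.
module Submission where

open import Defs
open import Data.Nat using (ℕ; suc; _+_; _*_; _≟_)
open import Data.Nat.Properties using (+-identityʳ; *-identityˡ; *-distribʳ-+)
open import Data.Nat.Tactic.RingSolver using (solve-∀)
open import Data.Product using (_,_)
open import Data.Empty using (⊥-elim)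
open import Function using (_∘_)
open import Relation.Nullary using (yes; no)
open import Relation.Binary.PropositionalEquality
  using (_≡_; _≢_; refl; sym; cong; cong₂; module ≡-Reasoning)
  renaming (trans to ≡-trans)

module _ {n : ℕ} where

  occ-fv-self : ∀ y → occ {n} y (fv y) ≡ 1
  occ-fv-self y with y ≟ y
  ... | yes _ = refl
  ... | no y≢y = ⊥-elim (y≢y refl)

  occ-fv-≢ : ∀ {y w} → y ≢ w → occ {n} y (fv w) ≡ 0
  occ-fv-≢ {y} {w} y≢w with y ≟ w
  ... | yes y≡w = ⊥-elim (y≢w y≡w)
  ... | no _ = refl

  occ-closeTm-self : ∀ k z (s : Tm n) → occ z (closeTm k z s) ≡ 0
  occ-closeTm-self k z (fv w) with z ≟ w
  ... | yes _ = refl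
  ... | no z≢w = occ-fv-≢ z≢w
  occ-closeTm-self k z (bv m) = refl
  occ-closeTm-self k z (coe i j) = refl
  occ-closeTm-self k z (app s t) = cong₂ _+_ (occ-closeTm-self k z s) (occ-closeTm-self k z t)
  occ-closeTm-self k z (lam A t) = occ-closeTm-self (suc k) z t
  occ-closeTm-self k z (tapp t A) = occ-closeTm-self k z t
  occ-closeTm-self k z (tlam t) = occ-closeTm-self k z t

  occ-closeTm-≢ : ∀ k {y z} (s : Tm n) → y ≢ z → occ y (closeTm k z s) ≡ occ y s
  occ-closeTm-≢ k {y} {z} (fv w) y≢z with z ≟ w
  ... | yes refl = sym (occ-fv-≢ y≢z)
  ... | no _ = refl
  occ-closeTm-≢ k (bv m) y≢z = refl
  occ-closeTm-≢ k (coe i j) y≢z = refl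
  occ-closeTm-≢ k (app s t) y≢z = cong₂ _+_ (occ-closeTm-≢ k s y≢z) (occ-closeTm-≢ k t y≢z)
  occ-closeTm-≢ k (lam A t) y≢z = occ-closeTm-≢ (suc k) t y≢z
  occ-closeTm-≢ k (tapp t A) y≢z = occ-closeTm-≢ k t y≢z
  occ-closeTm-≢ k (tlam t) y≢z = occ-closeTm-≢ k t y≢z

  occ-closeTmTy : ∀ k X y (s : Tm n) → occ y (closeTmTy k X s) ≡ occ y s
  occ-closeTmTy k X y (fv w) = refl
  occ-closeTmTy k X y (bv m) = refl
  occ-closeTmTy k X y (coe i j) = refl
  occ-closeTmTy k X y (app s t) = cong₂ _+_ (occ-closeTmTy k X y s) (occ-closeTmTy k X y t)
  occ-closeTmTy k X y (lam A t) = occ-closeTmTy k X y t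
  occ-closeTmTy k X y (tapp t A) = occ-closeTmTy k X y t
  occ-closeTmTy k X y (tlam t) = occ-closeTmTy (suc k) X y t

  occ-[≔]-self : ∀ {y} (u t : Tm n) → occ y (u [ y ≔ t ]) ≡ occ y u * occ y t
  occ-[≔]-self {y} (fv w) t with y ≟ w
  ... | yes refl = sym (+-identityʳ (occ y t))
  ... | no y≢w rewrite occ-fv-≢ {y = y} y≢w = refl
  occ-[≔]-self (bv m) t = refl
  occ-[≔]-self (coe i j) t = refl
  occ-[≔]-self {y} (app u₁ u₂) t = begin
    occ y (u₁ [ y ≔ t ]) + occ y (u₂ [ y ≔ t ]) ≡⟨ cong₂ _+_ (occ-[≔]-self u₁ t) (occ-[≔]-self u₂ t) ⟩
    occ y u₁ * occ y t + occ y u₂ * occ y t     ≡⟨ *-distribʳ-+ (occ y t) (occ y u₁) (occ y u₂) ⟨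
    (occ y u₁ + occ y u₂) * occ y t             ∎
    where open ≡-Reasoning
  occ-[≔]-self (lam A u) t = occ-[≔]-self u t
  occ-[≔]-self (tapp u A) t = occ-[≔]-self u t
  occ-[≔]-self (tlam u) t = occ-[≔]-self u t

  occ-[≔]-≢ : ∀ {y z} (u t : Tm n) → z ≢ y → occ z (u [ y ≔ t ]) ≡ occ z u + occ y u * occ z t
  occ-[≔]-≢ {y} {z} (fv w) t z≢y with y ≟ w
  ... | yes refl = cong₂ _+_ (sym (occ-fv-≢ z≢y)) (sym (+-identityʳ (occ z t)))
  ... | no _ = sym (+-identityʳ (occ z (fv {n} w)))
  occ-[≔]-≢ (bv m) t z≢y = refl
  occ-[≔]-≢ (coe i j) t z≢y = refl
  occ-[≔]-≢ {y} {z} (app u₁ u₂) t z≢y = begin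
    occ z (u₁ [ y ≔ t ]) + occ z (u₂ [ y ≔ t ])
      ≡⟨ cong₂ _+_ (occ-[≔]-≢ u₁ t z≢y) (occ-[≔]-≢ u₂ t z≢y) ⟩
    occ z u₁ + occ y u₁ * occ z t + (occ z u₂ + occ y u₂ * occ z t)
      ≡⟨ regroup (occ z u₁) (occ z u₂) (occ y u₁) (occ y u₂) (occ z t) ⟩
    occ z u₁ + occ z u₂ + (occ y u₁ + occ y u₂) * occ z t
      ∎
    where
    open ≡-Reasoning
    regroup : ∀ a b c d e → a + c * e + (b + d * e) ≡ a + b + (c + d) * e
    regroup = solve-∀
  occ-[≔]-≢ (lam A u) t z≢y = occ-[≔]-≢ u t z≢y
  occ-[≔]-≢ (tapp u A) t z≢y = occ-[≔]-≢ u t z≢y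
  occ-[≔]-≢ (tlam u) t z≢y = occ-[≔]-≢ u t z≢y

  infix 4 _≈ₒ_

  -- A record rather than a function on terms, so that both terms are inferable from it.
  record _≈ₒ_ (s t : Tm n) : Set where
    constructor same-occ
    field occ-≡ : ∀ y → occ y s ≡ occ y t

  open _≈ₒ_ public

  ≈ₒ-refl : ∀ {s : Tm n} → s ≈ₒ s
  ≈ₒ-refl = same-occ λ _ → refl

  ≈ₒ-trans : ∀ {s t u : Tm n} → s ≈ₒ t → t ≈ₒ u → s ≈ₒ u
  ≈ₒ-trans s≈t t≈u = same-occ λ y → ≡-trans (occ-≡ s≈t y) (occ-≡ t≈u y)

  ≈ₒ-fv⇒Linear : ∀ {v} {s : Tm n} → s ≈ₒ fv v → Linear v s
  ≈ₒ-fv⇒Linear {v} (same-occ s≈v) =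
    ≡-trans (s≈v v) (occ-fv-self v) , λ y y≢v → ≡-trans (s≈v y) (occ-fv-≢ y≢v)

  app-cong-≈ₒ : ∀ {s s′ t t′ : Tm n} → s ≈ₒ s′ → t ≈ₒ t′ → app s t ≈ₒ app s′ t′
  app-cong-≈ₒ s≈s′ t≈t′ = same-occ λ y → cong₂ _+_ (occ-≡ s≈s′ y) (occ-≡ t≈t′ y)

  closeTm-cong-≈ₒ : ∀ k z {s t : Tm n} → s ≈ₒ t → closeTm k z s ≈ₒ closeTm k z t
  closeTm-cong-≈ₒ k z {s} {t} s≈t = same-occ occ-closed
    where
    occ-closed : ∀ y → occ y (closeTm k z s) ≡ occ y (closeTm k z t)
    occ-closed y with y ≟ z
    ... | yes refl = ≡-trans (occ-closeTm-self k y s) (sym (occ-closeTm-self k y t))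
    ... | no y≢z = begin
      occ y (closeTm k z s) ≡⟨ occ-closeTm-≢ k s y≢z ⟩
      occ y s               ≡⟨ occ-≡ s≈t y ⟩
      occ y t               ≡⟨ occ-closeTm-≢ k t y≢z ⟨
      occ y (closeTm k z t) ∎
      where open ≡-Reasoning

  ƛ-cong-≈ₒ : ∀ z C {s t : Tm n} → s ≈ₒ t → ƛ z C s ≈ₒ ƛ z C t
  ƛ-cong-≈ₒ z C s≈t = same-occ (occ-≡ (closeTm-cong-≈ₒ 0 z s≈t))

  Λ-≈ₒ : ∀ X (s : Tm n) → Λ X s ≈ₒ s
  Λ-≈ₒ X s = same-occ λ y → occ-closeTmTy 0 X y s

  [≔]-linear-≈ₒ : ∀ {y} {u : Tm n} (t : Tm n) → u ≈ₒ fv y → u [ y ≔ t ] ≈ₒ t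
  [≔]-linear-≈ₒ {y} {u} t u≈y = same-occ occ-substituted
    where
    open ≡-Reasoning
    occ-y-u : occ y u ≡ 1
    occ-y-u = ≡-trans (occ-≡ u≈y y) (occ-fv-self y)

    occ-substituted : ∀ z → occ z (u [ y ≔ t ]) ≡ occ z t
    occ-substituted z with z ≟ y
    ... | yes refl = begin
      occ z (u [ z ≔ t ]) ≡⟨ occ-[≔]-self u t ⟩
      occ z u * occ z t   ≡⟨ cong (_* occ z t) occ-y-u ⟩
      1 * occ z t         ≡⟨ *-identityˡ (occ z t) ⟩
      occ z t             ∎
    ... | no z≢y = begin
      occ z (u [ y ≔ t ])         ≡⟨ occ-[≔]-≢ u t z≢y ⟩
      occ z u + occ y u * occ z t ≡⟨ cong₂ _+_ (≡-trans (occ-≡ u≈y z) (occ-fv-≢ z≢y))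
                                               (cong (_* occ z t) occ-y-u) ⟩
      1 * occ z t                 ≡⟨ *-identityˡ (occ z t) ⟩
      occ z t                     ∎

  ƛ-app-fv-≈ₒ : ∀ {f z} (C : Ty n) → f ≢ z → ƛ z C (app (fv f) (fv z)) ≈ₒ fv f
  ƛ-app-fv-≈ₒ {f} {z} C f≢z = same-occ occ-ƛ
    where
    occ-ƛ : ∀ y → occ y (closeTm 0 z (app (fv f) (fv z))) ≡ occ y (fv {n} f)
    occ-ƛ y with y ≟ z
    ... | yes refl = ≡-trans (occ-closeTm-self 0 y (app (fv f) (fv y))) (sym (occ-fv-≢ (f≢z ∘ sym)))
    ... | no y≢z = begin
      occ y (closeTm 0 z (app (fv f) (fv z))) ≡⟨ occ-closeTm-≢ 0 (app (fv f) (fv z)) y≢z ⟩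
      occ y (fv {n} f) + occ y (fv {n} z)     ≡⟨ cong (occ y (fv {n} f) +_) (occ-fv-≢ y≢z) ⟩
      occ y (fv {n} f) + 0                    ≡⟨ +-identityʳ (occ y (fv {n} f)) ⟩
      occ y (fv {n} f)                        ∎
      where open ≡-Reasoning

module _ {n : ℕ} (R : BaseCoercions n) where

  Der⇒≈ₒ-fv : ∀ {v A B s} → Der R v A s B → s ≈ₒ fv v
  Der⇒≈ₒ-fv (axiom x _) = same-occ λ _ → refl
  Der⇒≈ₒ-fv (trans d e) = ≈ₒ-trans ([≔]-linear-≈ₒ _ (Der⇒≈ₒ-fv e)) (Der⇒≈ₒ-fv d)
  Der⇒≈ₒ-fv (arrow {z = z} {C = C} f f≢z d e) =
    ≈ₒ-trans (ƛ-cong-≈ₒ z C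
               (≈ₒ-trans ([≔]-linear-≈ₒ _ (Der⇒≈ₒ-fv d))
                         (app-cong-≈ₒ ≈ₒ-refl (Der⇒≈ₒ-fv e))))
             (ƛ-app-fv-≈ₒ C f≢z)
  Der⇒≈ₒ-fv (arrow-cov f w T f≢w d) =
    ≈ₒ-trans (ƛ-cong-≈ₒ w T ([≔]-linear-≈ₒ _ (Der⇒≈ₒ-fv d))) (ƛ-app-fv-≈ₒ T f≢w)
  Der⇒≈ₒ-fv (arrow-contra {x = x} {A = A} g T g≢x d) =
    ≈ₒ-trans (ƛ-cong-≈ₒ x A (app-cong-≈ₒ ≈ₒ-refl (Der⇒≈ₒ-fv d))) (ƛ-app-fv-≈ₒ A g≢x)
  Der⇒≈ₒ-fv (Π-intro {t = t} X _ d) = ≈ₒ-trans (Λ-≈ₒ X t) (Der⇒≈ₒ-fv d)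
  Der⇒≈ₒ-fv (Π-elim W d) = same-occ (occ-≡ (Der⇒≈ₒ-fv d))

mainTheorem1 : ∀ {n : ℕ} (R : BaseCoercions n) {v : Name} {A B : Ty n} {s : Tm n} →
                 Der R v A s B → Linear v s
mainTheorem1 R d = ≈ₒ-fv⇒Linear (Der⇒≈ₒ-fv R d)
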